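{- Let $n,k,t,r$ be positive integers with $1\leq r\leq k$. Let $f(n,k,t,r)$ be the number of $k$-tuples $(\alpha^1,\ldots,\alpha^k)$ of partitions with $|\alpha^1|+\cdots+|\alpha^k|=n$ such that $\max\{\ell(\alpha^1),\ldots,\ell(\alpha^k)\}=t$ and $r$ is the largest index with $\ell(\alpha^r)=t$. Let $g(n,k,t,r)$ be the number of unrestricted Schmidt $k$-partitions of $n$ with length exactly $(t-1)k+r$. Then $f(n,k,t,r)=g(n,k,t,r)$.
   Context: A partition is a finite weakly decreasing sequence of positive integers (possibly empty); $\ell(\lambda)$ denotes its number of parts and $|\lambda|$ the sum of its parts. An unrestricted Schmidt $k$-partition of $n$ is a partition $(\lambda_1,\lambda_2,\ldots)$ with $\lambda_1\geq\lambda_2\geq\cdots$ and $\lambda_1+\lambda_{k+1}+\lambda_{2k+1}+\cdots=n$; its length is its number of parts. -}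

module Defs where

open import Data.Nat using (ℕ; zero; suc; _+_; _*_; _∸_; _≤_; _<_; _≥_; _⊔_; s≤s; z≤n)
open import Data.Nat.Properties using (≤-trans; n≤1+n)
open import Data.List using (List; []; _∷_; length)
open import Data.Nat.ListAction using (sum)
open import Data.List.Relation.Unary.All as LAll using ()
open import Data.List.Relation.Unary.Linked using (Linked)
open import Data.Vec as Vec using (Vec; toList; lookup)
open import Data.Vec.Relation.Unary.All as VAll using ()
open import Data.Fin using (Fin; fromℕ<)
open import Data.Product using (Σ; _×_)
open import Relation.Binary.PropositionalEquality using (_≡_)

IsPartition : List ℕ → Set
IsPartition xs = LAll.All (λ x → 0 < x) xs × Linked _≥_ xs

size : List ℕ → ℕ
size = sum

len : List ℕ → ℕ
len = length

maxList : List ℕ → ℕ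
maxList = Data.List.foldr _⊔_ 0

-- Schmidt sum: λ₁ + λ_{k+1} + λ_{2k+1} + ⋯
-- schmidtAux k c xs : skip c entries, then take one and reset the counter to k ∸ 1.
schmidtAux : ℕ → ℕ → List ℕ → ℕ
schmidtAux k c       []       = 0
schmidtAux k zero    (x ∷ xs) = x + schmidtAux k (k ∸ 1) xs
schmidtAux k (suc c) (x ∷ xs) = schmidtAux k c xs

schmidtSum : ℕ → List ℕ → ℕ
schmidtSum k xs = schmidtAux k 0 xs

-- 0-based position r ∸ 1 as an element of Fin k, from 1 ≤ r ≤ k
pos : (k r : ℕ) → 1 ≤ r → r ≤ k → Fin k
pos k (suc r) (s≤s _) r≤k = fromℕ< {r} r≤k

-- The set counted by f(n,k,t,r): k-tuples (α¹,…,αᵏ) of partitions with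
-- total size n, max length t, and r the largest index with ℓ(αʳ) = t.
-- "largest index" is expressed as: ℓ(αʳ) = t and every αʲ with j > r has
-- ℓ(αʲ) < t (equivalent to ≠ t since all lengths are ≤ max = t).
F : (n k t r : ℕ) → 1 ≤ r → r ≤ k → Set
F n k t r 1≤r r≤k =
  Σ (Vec (List ℕ) k) λ α →
      VAll.All IsPartition α
    × sum (toList (Vec.map size α)) ≡ n
    × maxList (toList (Vec.map len α)) ≡ t
    × len (lookup α (pos k r 1≤r r≤k)) ≡ t
    × LAll.All (λ m → m < t) (Data.List.drop r (toList (Vec.map len α)))

G : (n k t r : ℕ) → Set
G n k t r =
  Σ (List ℕ) λ λs →
      IsPartition λs
    × schmidtSum k λs ≡ n
    × len λs ≡ (t ∸ 1) * k + r

-- A partition with at most m parts is the same as its difference sequence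
-- dᵢ = λᵢ − λᵢ₊₁ ∈ ℕᵐ, and its size is Σᵢ i·dᵢ.  Write the difference sequence
-- of a Schmidt k-partition with at most tk parts as a t × k matrix (row-major):
-- then λ₁ + λ_{k+1} + ⋯ is Σᵢ i·(sum of row i), which is also the total size of
-- the k partitions whose difference sequences are the columns.  The Schmidt
-- partition has length (t−1)k + r exactly when the last nonzero entry of the
-- matrix sits in column r of the last row, i.e. when column r gives a partition
-- with t parts and the later columns give partitions with fewer.
module Submission where

open import Defs
open import Data.Nat using (ℕ; zero; suc; _+_; _*_; _∸_; _≤_; _<_; s≤s; s≤s⁻¹; z≤n)
open import Data.Nat.Properties
open import Algebra.Properties.CommutativeSemigroup +-commutativeSemigroup using (interchange)
open import Data.List as List using (List; []; _∷_)
open import Data.Nat.ListAction using (sum)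
open import Data.List.Relation.Unary.All as All using ([]; _∷_)
open import Data.List.Relation.Unary.Linked as Linked using ([]; [-]; _∷_)
open import Data.Vec as Vec
  using (Vec; []; _∷_; _++_; concat; transpose; toList; lookup; last; map; zipWith; replicate; group)
open import Data.Vec.Properties
  using (zipWith-is-⊛; transpose-replicate; ++-injectiveˡ; ++-injectiveʳ; sum-++;
         map-∘; map-cong; map-id; lookup-map)
open import Data.Vec.Relation.Unary.All as VAll using ([]; _∷_)
open import Data.Vec.Relation.Unary.All.Properties using (map⁺)
open import Data.Fin using (Fin; zero; suc; fromℕ<)
open import Data.Product using (Σ; _×_; _,_; proj₁; proj₂)
open import Data.Product.Properties using (Σ-≡,≡→≡)
open import Data.Product.Function.Dependent.Propositional using (congˡ)
open import Data.Empty using (⊥-elim)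
open import Function using (_∘_; _⇔_; _↔_; mk⇔; mk↔ₛ′; Equivalence)
open import Function.Construct.Composition using (_⇔-∘_)
open import Function.Properties.Inverse using (↔-sym; ↔-trans)
open import Function.Related.Propositional using (K-reflexive; bijection; module EquationalReasoning)
open import Relation.Nullary.Irrelevant using (Irrelevant)
open import Relation.Binary.PropositionalEquality

private variable
  A B : Set
  c m n : ℕ

×-irrelevant : Irrelevant A → Irrelevant B → Irrelevant (A × B)
×-irrelevant irrA irrB (a , b) (a′ , b′) = cong₂ _,_ (irrA a a′) (irrB b b′)

⇔⇒↔ : Irrelevant A → Irrelevant B → A ⇔ B → A ↔ B
⇔⇒↔ irrA irrB A⇔B = mk↔ₛ′ to from (λ b → irrB _ b) (λ a → irrA _ a)
  where open Equivalence A⇔B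

Σ-⇔ : {P Q : A → Set} → (∀ a → Irrelevant (P a)) → (∀ a → Irrelevant (Q a)) →
      (∀ a → P a ⇔ Q a) → Σ A P ↔ Σ A Q
Σ-⇔ irrP irrQ P⇔Q = congˡ (λ {a} → ⇔⇒↔ (irrP a) (irrQ a) (P⇔Q a))

Σ-↔-reindex : {P : A → Set} (f : A → B) (g : B → A) →
              (∀ a → P a → g (f a) ≡ a) → (∀ b → f (g b) ≡ b) → (∀ a → Irrelevant (P a)) →
              Σ A P ↔ Σ B (P ∘ g)
Σ-↔-reindex {P = P} f g gf≡id fg≡id irrP = mk↔ₛ′ to from to∘from from∘to
  where
  to : Σ _ P → Σ _ (P ∘ g)
  to (a , p) = f a , subst P (sym (gf≡id a p)) p
  from : Σ _ (P ∘ g) → Σ _ P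
  from (b , q) = g b , q
  to∘from : ∀ bq → to (from bq) ≡ bq
  to∘from (b , q) = Σ-≡,≡→≡ (fg≡id b , irrP (g b) _ q)
  from∘to : ∀ ap → from (to ap) ≡ ap
  from∘to (a , p) = Σ-≡,≡→≡ (gf≡id a p , irrP a _ p)

IsPartition-irrelevant : ∀ xs → Irrelevant (IsPartition xs)
IsPartition-irrelevant xs = ×-irrelevant (All.irrelevant <-irrelevant) (Linked.irrelevant ≤-irrelevant)

leading : List ℕ → ℕ
leading []      = 0
leading (x ∷ _) = x

push : ℕ → List ℕ → List ℕ
push d       (y ∷ ys) = d + y ∷ y ∷ ys
push zero    []       = []
push (suc d) []       = suc d ∷ []

-- The partition with parts λᵢ = dᵢ + dᵢ₊₁ + ⋯ + dₘ, zero parts omitted.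
fromDiffs : Vec ℕ m → List ℕ
fromDiffs []       = []
fromDiffs (d ∷ ds) = push d (fromDiffs ds)

toDiffs : (m : ℕ) → List ℕ → Vec ℕ m
toDiffs zero    _        = []
toDiffs (suc m) []       = 0 ∷ toDiffs m []
toDiffs (suc m) (x ∷ xs) = x ∸ leading xs ∷ toDiffs m xs

-- weight d = Σᵢ i·dᵢ, counting positions from 1.
weight : Vec ℕ m → ℕ
weight []       = 0
weight (d ∷ ds) = d + Vec.sum ds + weight ds

push-isPartition : ∀ d {l} → IsPartition l → IsPartition (push d l)
push-isPartition d       {y ∷ ys} (y>0 ∷ ps , lk) = ≤-trans y>0 (m≤n+m y d) ∷ y>0 ∷ ps , m≤n+m y d ∷ lk
push-isPartition zero    {[]}     p               = p
push-isPartition (suc d) {[]}     _               = s≤s z≤n ∷ [] , [-]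

fromDiffs-isPartition : (d : Vec ℕ m) → IsPartition (fromDiffs d)
fromDiffs-isPartition []       = [] , []
fromDiffs-isPartition (d ∷ ds) = push-isPartition d (fromDiffs-isPartition ds)

length-push≤ : ∀ d l → len (push d l) ≤ suc (len l)
length-push≤ d       (y ∷ ys) = ≤-refl
length-push≤ zero    []       = z≤n
length-push≤ (suc d) []       = ≤-refl

length-fromDiffs≤ : (d : Vec ℕ m) → len (fromDiffs d) ≤ m
length-fromDiffs≤ []       = z≤n
length-fromDiffs≤ (d ∷ ds) = ≤-trans (length-push≤ d (fromDiffs ds)) (s≤s (length-fromDiffs≤ ds))

leading-push : ∀ d l → leading (push d l) ≡ d + leading l
leading-push d       (y ∷ ys) = refl
leading-push zero    []       = refl
leading-push (suc d) []       = sym (+-identityʳ (suc d))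

leading-fromDiffs : (d : Vec ℕ m) → leading (fromDiffs d) ≡ Vec.sum d
leading-fromDiffs []       = refl
leading-fromDiffs (d ∷ ds) = trans (leading-push d (fromDiffs ds)) (cong (d +_) (leading-fromDiffs ds))

sum-push : ∀ d l → sum (push d l) ≡ d + leading l + sum l
sum-push d       (y ∷ ys) = refl
sum-push zero    []       = refl
sum-push (suc d) []       = sym (+-identityʳ (suc d + 0))

size-fromDiffs : (d : Vec ℕ m) → size (fromDiffs d) ≡ weight d
size-fromDiffs []       = refl
size-fromDiffs (d ∷ ds) = trans (sum-push d (fromDiffs ds))
  (cong₂ (λ s w → d + s + w) (leading-fromDiffs ds) (size-fromDiffs ds))

toDiffs-push : ∀ m d l → toDiffs (suc m) (push d l) ≡ d ∷ toDiffs m l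
toDiffs-push m d       (y ∷ ys) = cong (_∷ toDiffs m (y ∷ ys)) (m+n∸n≡m d y)
toDiffs-push m zero    []       = refl
toDiffs-push m (suc d) []       = refl

toDiffs-fromDiffs : (d : Vec ℕ m) → toDiffs m (fromDiffs d) ≡ d
toDiffs-fromDiffs []       = refl
toDiffs-fromDiffs (d ∷ ds) = trans (toDiffs-push _ d (fromDiffs ds)) (cong (d ∷_) (toDiffs-fromDiffs ds))

push-leading : ∀ x xs → IsPartition (x ∷ xs) → push (x ∸ leading xs) xs ≡ x ∷ xs
push-leading zero    []       (() ∷ _ , _)
push-leading (suc x) []       _              = refl
push-leading x       (y ∷ ys) (_ , y≤x ∷ _)  = cong (_∷ y ∷ ys) (m∸n+n≡m y≤x)

fromDiffs-toDiffs : ∀ m xs → IsPartition xs → len xs ≤ m → fromDiffs (toDiffs m xs) ≡ xs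
fromDiffs-toDiffs zero    []       _ _       = refl
fromDiffs-toDiffs (suc m) []       _ _       = cong (push 0) (fromDiffs-toDiffs m [] ([] , []) z≤n)
fromDiffs-toDiffs (suc m) (x ∷ xs) p (s≤s l) = trans
  (cong (push (x ∸ leading xs)) (fromDiffs-toDiffs m xs (All.tail (proj₁ p) , Linked.tail (proj₂ p)) l))
  (push-leading x xs p)

length-push : ∀ d l → 0 < n → len (push d l) ≡ suc n ⇔ len l ≡ n
length-push d (y ∷ ys) _   = mk⇔ suc-injective (cong suc)
length-push d []       0<n = mk⇔
  (λ eq → ⊥-elim (<⇒≱ 0<n (s≤s⁻¹ (≤-trans (≤-reflexive (sym eq)) (length-push≤ d [])))))
  (λ eq → ⊥-elim (<⇒≢ 0<n eq))

push≡[] : ∀ d l → push d l ≡ [] → d ≡ 0 × l ≡ []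
push≡[] zero    []       _  = refl , refl
push≡[] (suc d) []       ()
push≡[] d       (y ∷ ys) ()

fromDiffs≡[] : (d : Vec ℕ m) → fromDiffs d ≡ [] ⇔ All.All (_≡ 0) (toList d)
fromDiffs≡[] d = mk⇔ (to d) (from d)
  where
  to : (d : Vec ℕ m) → fromDiffs d ≡ [] → All.All (_≡ 0) (toList d)
  to []       _  = []
  to (x ∷ ds) eq = let x≡0 , rest≡[] = push≡[] x (fromDiffs ds) eq in x≡0 ∷ to ds rest≡[]
  from : (d : Vec ℕ m) → All.All (_≡ 0) (toList d) → fromDiffs d ≡ []
  from []        _          = refl
  from (.0 ∷ ds) (refl ∷ zs) = cong (push 0) (from ds zs)

length-push≡1 : ∀ d l → len (push d l) ≡ 1 ⇔ (0 < d × l ≡ [])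
length-push≡1 d       (y ∷ ys) = mk⇔ (λ ()) (λ ())
length-push≡1 zero    []       = mk⇔ (λ ()) (λ ())
length-push≡1 (suc d) []       = mk⇔ (λ _ → s≤s z≤n , refl) (λ _ → refl)

LastPositive : (j : ℕ) → j < m → Vec ℕ m → Set
LastPositive j j<m d = 0 < lookup d (fromℕ< j<m) × All.All (_≡ 0) (List.drop (suc j) (toList d))

LastPositive-irrelevant : ∀ j (j<m : j < m) d → Irrelevant (LastPositive j j<m d)
LastPositive-irrelevant j j<m d = ×-irrelevant <-irrelevant (All.irrelevant ≡-irrelevant)

length-fromDiffs : ∀ j (j<m : j < m) (d : Vec ℕ m) → len (fromDiffs d) ≡ suc j ⇔ LastPositive j j<m d
length-fromDiffs zero    _         (x ∷ ds) =
  mk⇔ (λ (0<x , eq) → 0<x , Equivalence.to (fromDiffs≡[] ds) eq)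
      (λ (0<x , zs) → 0<x , Equivalence.from (fromDiffs≡[] ds) zs)
  ⇔-∘ length-push≡1 x (fromDiffs ds)
length-fromDiffs (suc j) (s≤s j<m) (x ∷ ds) =
  length-fromDiffs j j<m ds ⇔-∘ length-push x (fromDiffs ds) (s≤s z≤n)

length-fromDiffs-last : (d : Vec ℕ (suc m)) → len (fromDiffs d) ≡ suc m ⇔ 0 < last d
length-fromDiffs-last (zero  ∷ []) = mk⇔ (λ ()) (λ ())
length-fromDiffs-last (suc x ∷ []) = mk⇔ (λ _ → s≤s z≤n) (λ _ → refl)
length-fromDiffs-last (x ∷ y ∷ d)  =
  length-fromDiffs-last (y ∷ d) ⇔-∘ length-push x (fromDiffs (y ∷ d)) (s≤s z≤n)

length-fromDiffs<-last : (d : Vec ℕ (suc m)) → len (fromDiffs d) < suc m ⇔ last d ≡ 0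
length-fromDiffs<-last d = mk⇔
  (λ short → n≤0⇒n≡0 (≮⇒≥ (λ 0<last → <-irrefl (from last⇔ 0<last) short)))
  (λ last≡0 → ≤∧≢⇒< (length-fromDiffs≤ d) (λ full → <-irrefl (sym last≡0) (to last⇔ full)))
  where
  open Equivalence
  last⇔ = length-fromDiffs-last d

length-fromDiffs-++ : (a : Vec ℕ c) (b : Vec ℕ n) → 0 < m →
                      len (fromDiffs (a ++ b)) ≡ c + m ⇔ len (fromDiffs b) ≡ m
length-fromDiffs-++     []      b _   = mk⇔ (λ eq → eq) (λ eq → eq)
length-fromDiffs-++ {c = suc c} {m = m} (x ∷ a) b 0<m =
  length-fromDiffs-++ a b 0<m ⇔-∘ length-push x (fromDiffs (a ++ b)) (≤-trans 0<m (m≤n+m m c))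

fromDiffs-++-[] : (d : Vec ℕ m) → fromDiffs (d ++ []) ≡ fromDiffs d
fromDiffs-++-[] []       = refl
fromDiffs-++-[] (x ∷ d) = cong (push x) (fromDiffs-++-[] d)

schmidtAux-push-zero : ∀ k d l → schmidtAux k 0 (push d l) ≡ d + leading l + schmidtAux k (k ∸ 1) l
schmidtAux-push-zero k d       (y ∷ ys) = refl
schmidtAux-push-zero k zero    []       = refl
schmidtAux-push-zero k (suc d) []       = sym (+-identityʳ (suc d + 0))

schmidtAux-push-suc : ∀ k c d l → schmidtAux k (suc c) (push d l) ≡ schmidtAux k c l
schmidtAux-push-suc k c d       (y ∷ ys) = refl
schmidtAux-push-suc k c zero    []       = refl
schmidtAux-push-suc k c (suc d) []       = refl

schmidtAux-skip : ∀ k (a : Vec ℕ c) (b : Vec ℕ n) →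
                  schmidtAux k c (fromDiffs (a ++ b)) ≡ schmidtSum k (fromDiffs b)
schmidtAux-skip k []      b = refl
schmidtAux-skip k (x ∷ a) b = trans (schmidtAux-push-suc k _ x (fromDiffs (a ++ b))) (schmidtAux-skip k a b)

transpose-∷ : (xs : Vec A n) (xss : Vec (Vec A n) m) →
              transpose (xs ∷ xss) ≡ zipWith _∷_ xs (transpose xss)
transpose-∷ xs xss = sym (zipWith-is-⊛ _∷_ xs (transpose xss))

transpose-zipWith-∷ : (xs : Vec A n) (xss : Vec (Vec A m) n) →
                      transpose (zipWith _∷_ xs xss) ≡ xs ∷ transpose xss
transpose-zipWith-∷ []       []         = refl
transpose-zipWith-∷ (x ∷ xs) (ys ∷ xss) = begin
  transpose ((x ∷ ys) ∷ zipWith _∷_ xs xss)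
    ≡⟨ transpose-∷ (x ∷ ys) (zipWith _∷_ xs xss) ⟩
  zipWith _∷_ (x ∷ ys) (transpose (zipWith _∷_ xs xss))
    ≡⟨ cong (zipWith _∷_ (x ∷ ys)) (transpose-zipWith-∷ xs xss) ⟩
  (x ∷ xs) ∷ zipWith _∷_ ys (transpose xss)
    ≡⟨ cong ((x ∷ xs) ∷_) (transpose-∷ ys xss) ⟨
  (x ∷ xs) ∷ transpose (ys ∷ xss)
    ∎
  where open ≡-Reasoning

transpose-involutive : (xss : Vec (Vec A n) m) → transpose (transpose xss) ≡ xss
transpose-involutive []         = transpose-replicate []
transpose-involutive (xs ∷ xss) = begin
  transpose (transpose (xs ∷ xss))               ≡⟨ cong transpose (transpose-∷ xs xss) ⟩
  transpose (zipWith _∷_ xs (transpose xss))     ≡⟨ transpose-zipWith-∷ xs (transpose xss) ⟩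
  xs ∷ transpose (transpose xss)                 ≡⟨ cong (xs ∷_) (transpose-involutive xss) ⟩
  xs ∷ xss                                       ∎
  where open ≡-Reasoning

map-last-zipWith-∷-[] : (xs : Vec A n) → map last (zipWith _∷_ xs (replicate n [])) ≡ xs
map-last-zipWith-∷-[] []       = refl
map-last-zipWith-∷-[] (x ∷ xs) = cong (x ∷_) (map-last-zipWith-∷-[] xs)

map-last-zipWith-∷ : (xs : Vec A n) (yss : Vec (Vec A (suc m)) n) →
                     map last (zipWith _∷_ xs yss) ≡ map last yss
map-last-zipWith-∷ []       []         = refl
map-last-zipWith-∷ (x ∷ xs) (ys ∷ yss) = cong (last ys ∷_) (map-last-zipWith-∷ xs yss)

map-last-transpose : (xss : Vec (Vec A n) (suc m)) → map last (transpose xss) ≡ last xss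
map-last-transpose (xs ∷ [])       = trans (cong (map last) (transpose-∷ xs [])) (map-last-zipWith-∷-[] xs)
map-last-transpose (xs ∷ ys ∷ xss) = begin
  map last (transpose (xs ∷ ys ∷ xss))               ≡⟨ cong (map last) (transpose-∷ xs (ys ∷ xss)) ⟩
  map last (zipWith _∷_ xs (transpose (ys ∷ xss)))   ≡⟨ map-last-zipWith-∷ xs (transpose (ys ∷ xss)) ⟩
  map last (transpose (ys ∷ xss))                    ≡⟨ map-last-transpose (ys ∷ xss) ⟩
  last (ys ∷ xss)                                    ∎
  where open ≡-Reasoning

sum-map-replicate : (f : A → ℕ) (x : A) → Vec.sum (map f (replicate n x)) ≡ n * f x
sum-map-replicate {n = zero}  f x = refl
sum-map-replicate {n = suc n} f x = cong (f x +_) (sum-map-replicate {n = n} f x)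

sum-map-+ : (f g : A → ℕ) (xs : Vec A n) →
            Vec.sum (map (λ x → f x + g x) xs) ≡ Vec.sum (map f xs) + Vec.sum (map g xs)
sum-map-+ f g []       = refl
sum-map-+ f g (x ∷ xs) = trans (cong (f x + g x +_) (sum-map-+ f g xs)) (interchange (f x) (g x) _ _)

sum-map-zipWith-∷ : (f : Vec ℕ (suc m) → ℕ) (g : Vec ℕ m → ℕ) →
                    (∀ x ys → f (x ∷ ys) ≡ x + g ys) →
                    (xs : Vec ℕ n) (yss : Vec (Vec ℕ m) n) →
                    Vec.sum (map f (zipWith _∷_ xs yss)) ≡ Vec.sum xs + Vec.sum (map g yss)
sum-map-zipWith-∷ f g f∷ []       []         = refl
sum-map-zipWith-∷ f g f∷ (x ∷ xs) (ys ∷ yss) =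
  trans (cong₂ _+_ (f∷ x ys) (sum-map-zipWith-∷ f g f∷ xs yss)) (interchange x (g ys) _ _)

sum-concat : (xss : Vec (Vec ℕ n) m) → Vec.sum (concat xss) ≡ Vec.sum (map Vec.sum xss)
sum-concat []         = refl
sum-concat (xs ∷ xss) = trans (sum-++ xs) (cong (Vec.sum xs +_) (sum-concat xss))

sum-map-sum-transpose : (xss : Vec (Vec ℕ n) m) →
                        Vec.sum (map Vec.sum (transpose xss)) ≡ Vec.sum (map Vec.sum xss)
sum-map-sum-transpose {n = n} [] = trans (sum-map-replicate {n = n} Vec.sum []) (*-zeroʳ n)
sum-map-sum-transpose (xs ∷ xss) = begin
  Vec.sum (map Vec.sum (transpose (xs ∷ xss)))
    ≡⟨ cong (Vec.sum ∘ map Vec.sum) (transpose-∷ xs xss) ⟩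
  Vec.sum (map Vec.sum (zipWith _∷_ xs (transpose xss)))
    ≡⟨ sum-map-zipWith-∷ Vec.sum Vec.sum (λ _ _ → refl) xs _ ⟩
  Vec.sum xs + Vec.sum (map Vec.sum (transpose xss))
    ≡⟨ cong (Vec.sum xs +_) (sum-map-sum-transpose xss) ⟩
  Vec.sum xs + Vec.sum (map Vec.sum xss)
    ∎
  where open ≡-Reasoning

sum-map-weight-transpose : (xss : Vec (Vec ℕ n) m) →
                           Vec.sum (map weight (transpose xss)) ≡ weight (map Vec.sum xss)
sum-map-weight-transpose {n = n} [] = trans (sum-map-replicate {n = n} weight []) (*-zeroʳ n)
sum-map-weight-transpose (xs ∷ xss) = begin
  Vec.sum (map weight (transpose (xs ∷ xss)))
    ≡⟨ cong (Vec.sum ∘ map weight) (transpose-∷ xs xss) ⟩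
  Vec.sum (map weight (zipWith _∷_ xs (transpose xss)))
    ≡⟨ sum-map-zipWith-∷ weight (λ ys → Vec.sum ys + weight ys) (λ x ys → +-assoc x _ _) xs _ ⟩
  Vec.sum xs + Vec.sum (map (λ ys → Vec.sum ys + weight ys) (transpose xss))
    ≡⟨ cong (Vec.sum xs +_) (sum-map-+ Vec.sum weight (transpose xss)) ⟩
  Vec.sum xs + (Vec.sum (map Vec.sum (transpose xss)) + Vec.sum (map weight (transpose xss)))
    ≡⟨ cong (Vec.sum xs +_) (cong₂ _+_ (sum-map-sum-transpose xss) (sum-map-weight-transpose xss)) ⟩
  Vec.sum xs + (Vec.sum (map Vec.sum xss) + weight (map Vec.sum xss))
    ≡⟨ +-assoc (Vec.sum xs) _ _ ⟨
  weight (map Vec.sum (xs ∷ xss))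
    ∎
  where open ≡-Reasoning

concat-injective : (xss yss : Vec (Vec A n) m) → concat xss ≡ concat yss → xss ≡ yss
concat-injective []         []         _  = refl
concat-injective (xs ∷ xss) (ys ∷ yss) eq =
  cong₂ _∷_ (++-injectiveˡ xs ys eq) (concat-injective xss yss (++-injectiveʳ xs ys eq))

rows : ∀ m → Vec A (m * n) → Vec (Vec A n) m
rows m xs = proj₁ (group m _ xs)

concat-rows : ∀ m (xs : Vec A (m * n)) → concat (rows m xs) ≡ xs
concat-rows m xs = sym (proj₂ (group m _ xs))

rows-concat : (xss : Vec (Vec A n) m) → rows m (concat xss) ≡ xss
rows-concat {m = m} xss = concat-injective _ xss (concat-rows m (concat xss))

schmidtSum-fromDiffs-concat : ∀ k (xss : Vec (Vec ℕ (suc k)) m) →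
                              schmidtSum (suc k) (fromDiffs (concat xss)) ≡ weight (map Vec.sum xss)
schmidtSum-fromDiffs-concat k []                = refl
schmidtSum-fromDiffs-concat k ((x ∷ xs) ∷ xss) = begin
  schmidtAux (suc k) 0 (push x (fromDiffs rest))
    ≡⟨ schmidtAux-push-zero (suc k) x (fromDiffs rest) ⟩
  x + leading (fromDiffs rest) + schmidtAux (suc k) k (fromDiffs rest)
    ≡⟨ cong₂ (λ s r → x + s + r) (leading-fromDiffs rest) (schmidtAux-skip (suc k) xs (concat xss)) ⟩
  x + Vec.sum rest + schmidtSum (suc k) (fromDiffs (concat xss))
    ≡⟨ cong₂ (λ s r → x + s + r) (trans (sum-++ xs) (cong (Vec.sum xs +_) (sum-concat xss)))
                                 (schmidtSum-fromDiffs-concat k xss) ⟩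
  x + (Vec.sum xs + Vec.sum (map Vec.sum xss)) + weight (map Vec.sum xss)
    ≡⟨ cong (_+ weight (map Vec.sum xss)) (+-assoc x _ _) ⟨
  weight (map Vec.sum ((x ∷ xs) ∷ xss))
    ∎
  where
  open ≡-Reasoning
  rest = xs ++ concat xss

length-fromDiffs-concat : ∀ {k t} (xss : Vec (Vec ℕ k) (suc t)) → 0 < m →
                          len (fromDiffs (concat xss)) ≡ t * k + m ⇔ len (fromDiffs (last xss)) ≡ m
length-fromDiffs-concat (xs ∷ []) _ rewrite fromDiffs-++-[] xs = mk⇔ (λ eq → eq) (λ eq → eq)
length-fromDiffs-concat {m = m} {k} {suc t} (xs ∷ ys ∷ xss) 0<m =
  subst (λ e → len (fromDiffs (concat (xs ∷ ys ∷ xss))) ≡ e ⇔ len (fromDiffs (last (ys ∷ xss))) ≡ m)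
        (sym (+-assoc k (t * k) m))
    (length-fromDiffs-concat (ys ∷ xss) 0<m
       ⇔-∘ length-fromDiffs-++ xs (concat (ys ∷ xss)) (≤-trans 0<m (m≤n+m m (t * k))))

maxList-lengths≤ : (α : Vec (List ℕ) n) → maxList (toList (map len α)) ≤ m →
                   VAll.All (λ xs → len xs ≤ m) α
maxList-lengths≤ []      _  = []
maxList-lengths≤ (x ∷ α) le =
  m⊔n≤o⇒m≤o (len x) _ le ∷ maxList-lengths≤ α (m⊔n≤o⇒n≤o (len x) _ le)

length-lookup≤maxList : (α : Vec (List ℕ) n) (i : Fin n) → len (lookup α i) ≤ maxList (toList (map len α))
length-lookup≤maxList (x ∷ α) zero    = m≤m⊔n (len x) _
length-lookup≤maxList (x ∷ α) (suc i) = ≤-trans (length-lookup≤maxList α i) (m≤n⊔m (len x) _)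

maxList-length-fromDiffs≤ : (C : Vec (Vec ℕ m) n) → maxList (toList (map len (map fromDiffs C))) ≤ m
maxList-length-fromDiffs≤ []      = z≤n
maxList-length-fromDiffs≤ (c ∷ C) = ⊔-lub (length-fromDiffs≤ c) (maxList-length-fromDiffs≤ C)

map-fromDiffs-toDiffs : (α : Vec (List ℕ) n) → VAll.All IsPartition α → VAll.All (λ xs → len xs ≤ m) α →
                        map fromDiffs (map (toDiffs m) α) ≡ α
map-fromDiffs-toDiffs []      []       []       = refl
map-fromDiffs-toDiffs (x ∷ α) (p ∷ ps) (l ∷ ls) =
  cong₂ _∷_ (fromDiffs-toDiffs _ x p l) (map-fromDiffs-toDiffs α ps ls)

map-toDiffs-fromDiffs : (C : Vec (Vec ℕ m) n) → map (toDiffs m) (map fromDiffs C) ≡ C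
map-toDiffs-fromDiffs C = trans (sym (map-∘ _ fromDiffs C)) (trans (map-cong toDiffs-fromDiffs C) (map-id C))

sum-size-fromDiffs : (C : Vec (Vec ℕ m) n) → sum (toList (map size (map fromDiffs C))) ≡ Vec.sum (map weight C)
sum-size-fromDiffs []      = refl
sum-size-fromDiffs (c ∷ C) = cong₂ _+_ (size-fromDiffs c) (sum-size-fromDiffs C)

length-lookup-fromDiffs : (C : Vec (Vec ℕ (suc m)) n) (i : Fin n) →
                          len (lookup (map fromDiffs C) i) ≡ suc m ⇔ 0 < lookup (map last C) i
length-lookup-fromDiffs C i rewrite lookup-map i fromDiffs C | lookup-map i last C =
  length-fromDiffs-last (lookup C i)

All-drop-length< : ∀ r (C : Vec (Vec ℕ (suc m)) n) →
                   All.All (_< suc m) (List.drop r (toList (map len (map fromDiffs C))))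
                   ⇔ All.All (_≡ 0) (List.drop r (toList (map last C)))
All-drop-length< zero    []      = mk⇔ (λ _ → []) (λ _ → [])
All-drop-length< zero    (c ∷ C) =
  mk⇔ (λ { (p ∷ ps) → to head⇔ p ∷ to tail⇔ ps }) (λ { (p ∷ ps) → from head⇔ p ∷ from tail⇔ ps })
  where
  open Equivalence
  head⇔ = length-fromDiffs<-last c
  tail⇔ = All-drop-length< zero C
All-drop-length< (suc r) []      = mk⇔ (λ _ → []) (λ _ → [])
All-drop-length< (suc r) (c ∷ C) = All-drop-length< r C

-- Here k, t, r are one less than in the theorem.
module _ (n k t r : ℕ) (r<k : r < suc k) where

  FCond : Vec (List ℕ) (suc k) → Set
  FCond α = VAll.All IsPartition α × sum (toList (map size α)) ≡ n
          × maxList (toList (map len α)) ≡ suc t × len (lookup α (fromℕ< r<k)) ≡ suc t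
          × All.All (_< suc t) (List.drop (suc r) (toList (map len α)))

  GCond : List ℕ → Set
  GCond λs = IsPartition λs × schmidtSum (suc k) λs ≡ n × len λs ≡ t * suc k + suc r

  ColumnCond : Vec (Vec ℕ (suc t)) (suc k) → Set
  ColumnCond C = Vec.sum (map weight C) ≡ n × LastPositive r r<k (map last C)

  RowCond : Vec (Vec ℕ (suc k)) (suc t) → Set
  RowCond M = weight (map Vec.sum M) ≡ n × LastPositive r r<k (last M)

  FCond-irrelevant : ∀ α → Irrelevant (FCond α)
  FCond-irrelevant α =
    ×-irrelevant (VAll.irrelevant (IsPartition-irrelevant _)) (×-irrelevant ≡-irrelevant
      (×-irrelevant ≡-irrelevant (×-irrelevant ≡-irrelevant (All.irrelevant <-irrelevant))))

  GCond-irrelevant : ∀ λs → Irrelevant (GCond λs)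
  GCond-irrelevant λs = ×-irrelevant (IsPartition-irrelevant λs) (×-irrelevant ≡-irrelevant ≡-irrelevant)

  ColumnCond-irrelevant : ∀ C → Irrelevant (ColumnCond C)
  ColumnCond-irrelevant C = ×-irrelevant ≡-irrelevant (LastPositive-irrelevant r r<k (map last C))

  RowCond-irrelevant : ∀ M → Irrelevant (RowCond M)
  RowCond-irrelevant M = ×-irrelevant ≡-irrelevant (LastPositive-irrelevant r r<k (last M))

  FCond⇔ColumnCond : ∀ C → FCond (map fromDiffs C) ⇔ ColumnCond C
  FCond⇔ColumnCond C = mk⇔
    (λ (_ , size≡n , _ , lenᵣ , rest) →
       trans (sym (sum-size-fromDiffs C)) size≡n , to lastᵣ lenᵣ , to rest⇔ rest)
    (λ (size≡n , 0<lastᵣ , rest) → let lenᵣ = from lastᵣ 0<lastᵣ in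
       map⁺ (VAll.universal fromDiffs-isPartition C) , trans (sum-size-fromDiffs C) size≡n ,
       ≤-antisym (maxList-length-fromDiffs≤ C)
                 (≤-trans (≤-reflexive (sym lenᵣ)) (length-lookup≤maxList (map fromDiffs C) rᶠ)) ,
       lenᵣ , from rest⇔ rest)
    where
    open Equivalence
    rᶠ = fromℕ< r<k
    lastᵣ = length-lookup-fromDiffs C rᶠ
    rest⇔ = All-drop-length< (suc r) C

  ColumnCond-transpose : ∀ M → ColumnCond (transpose M) ≡ RowCond M
  ColumnCond-transpose M =
    cong₂ (λ s l → s ≡ n × LastPositive r r<k l) (sum-map-weight-transpose M) (map-last-transpose M)

  GCond-concat⇔RowCond : ∀ M → GCond (fromDiffs (concat M)) ⇔ RowCond M
  GCond-concat⇔RowCond M = mk⇔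
    (λ (_ , sch≡n , len≡) → trans (sym schmidt) sch≡n , to lastPositive len≡)
    (λ (w≡n , lastPos) → fromDiffs-isPartition (concat M) , trans schmidt w≡n , from lastPositive lastPos)
    where
    open Equivalence
    schmidt = schmidtSum-fromDiffs-concat k M
    lastPositive = length-fromDiffs r r<k (last M) ⇔-∘ length-fromDiffs-concat M (s≤s z≤n)

  FCond-retract : ∀ α → FCond α → map fromDiffs (map (toDiffs (suc t)) α) ≡ α
  FCond-retract α (parts , _ , max≡ , _) =
    map-fromDiffs-toDiffs α parts (maxList-lengths≤ α (≤-reflexive max≡))

  GCond-length≤ : ∀ {λs} → GCond λs → len λs ≤ suc t * suc k
  GCond-length≤ (_ , _ , len≡) = ≤-trans (≤-reflexive len≡)
    (≤-trans (+-monoʳ-≤ (t * suc k) r<k) (≤-reflexive (+-comm (t * suc k) (suc k))))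

  open EquationalReasoning {k = bijection}

  F↔rows : Σ (Vec (List ℕ) (suc k)) FCond ↔ Σ (Vec (Vec ℕ (suc k)) (suc t)) RowCond
  F↔rows = begin
    Σ (Vec (List ℕ) (suc k)) FCond
      ↔⟨ Σ-↔-reindex (map (toDiffs (suc t))) (map fromDiffs)
           FCond-retract map-toDiffs-fromDiffs FCond-irrelevant ⟩
    Σ (Vec (Vec ℕ (suc t)) (suc k)) (FCond ∘ map fromDiffs)
      ↔⟨ Σ-⇔ (FCond-irrelevant ∘ map fromDiffs) ColumnCond-irrelevant FCond⇔ColumnCond ⟩
    Σ (Vec (Vec ℕ (suc t)) (suc k)) ColumnCond
      ↔⟨ Σ-↔-reindex transpose transpose
           (λ C _ → transpose-involutive C) transpose-involutive ColumnCond-irrelevant ⟩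
    Σ (Vec (Vec ℕ (suc k)) (suc t)) (ColumnCond ∘ transpose)
      ↔⟨ congˡ (λ {M} → K-reflexive (ColumnCond-transpose M)) ⟩
    Σ (Vec (Vec ℕ (suc k)) (suc t)) RowCond
      ∎

  G↔rows : Σ (List ℕ) GCond ↔ Σ (Vec (Vec ℕ (suc k)) (suc t)) RowCond
  G↔rows = begin
    Σ (List ℕ) GCond
      ↔⟨ Σ-↔-reindex (toDiffs (suc t * suc k)) fromDiffs
           (λ λs p → fromDiffs-toDiffs _ λs (proj₁ p) (GCond-length≤ p))
           toDiffs-fromDiffs GCond-irrelevant ⟩
    Σ (Vec ℕ (suc t * suc k)) (GCond ∘ fromDiffs)
      ↔⟨ Σ-↔-reindex (rows (suc t)) concat
           (λ v _ → concat-rows (suc t) v) rows-concat (GCond-irrelevant ∘ fromDiffs) ⟩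
    Σ (Vec (Vec ℕ (suc k)) (suc t)) (GCond ∘ fromDiffs ∘ concat)
      ↔⟨ Σ-⇔ (GCond-irrelevant ∘ fromDiffs ∘ concat) RowCond-irrelevant GCond-concat⇔RowCond ⟩
    Σ (Vec (Vec ℕ (suc k)) (suc t)) RowCond
      ∎

theorem7 : (n k t r : ℕ) → 1 ≤ n → 1 ≤ k → 1 ≤ t → (1≤r : 1 ≤ r) → (r≤k : r ≤ k) →
           F n k t r 1≤r r≤k ↔ G n k t r
theorem7 n (suc k) (suc t) (suc r) _ _ _ (s≤s z≤n) r<k =
  ↔-trans (F↔rows n k t r r<k) (↔-sym (G↔rows n k t r r<k))
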